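{- Let $\kappa,\lambda$ be non-zero cardinals. Then $\mathbf{D}_{\kappa\times\lambda}^\lambda\cong_{\mathrm{T}}\mathbf{D}_\kappa^\lambda\otimes\mathbf{D}_\lambda^\lambda$. In particular, $\mathfrak{d}_{\kappa\times\lambda}^\lambda=\max\{\mathfrak{d}_\kappa^\lambda,\mathfrak{d}_\lambda^\lambda\}$.
   Context: A relational system is $\langle X,Y,R\rangle$ with $R\subseteq X\times Y$; $\mathfrak{d}(\mathbf{R})$ is the least size of $D\subseteq Y$ with $\forall x\in X\,\exists y\in D\,(xRy)$. $\mathbf{R}\preceq_{\mathrm{T}}\mathbf{R}'$ (for $\mathbf{R}=\langle X,Y,R\rangle$, $\mathbf{R}'=\langle X',Y',R'\rangle$) means there are $\Psi_1:X\to X'$, $\Psi_2:Y'\to Y$ with $\Psi_1(x)R'y'\Rightarrow xR\Psi_2(y')$; $\cong_{\mathrm{T}}$ means Tukey below in both directions. $\mathbf{R}\otimes\mathbf{R}'=\langle X\times X',Y\times Y',R_\otimes\rangle$ where $(x,x')R_\otimes(y,y')$ iff $xRy$ and $x'R'y'$. For a directed partial order $S$, $\mathbf{D}_S^\lambda=\langle S^\lambda,S^\lambda,\leq\rangle$ with pointwise order $X\leq Y$ iff $X(\alpha)\leq_S Y(\alpha)$ for all $\alpha<\lambda$, and $\mathfrak{d}_S^\lambda=\mathfrak{d}(\mathbf{D}_S^\lambda)$. The cardinals $\kappa,\lambda$ carry their ordinal order, and $\kappa\times\lambda$ is ordered coordinatewise: $(\alpha,\beta)\leq(\alpha',\beta')$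 iff $\alpha\leq\alpha'$ and $\beta\leq\beta'$. -}

module Defs where

open import Data.Product using (Σ; _×_; _,_; ∃; proj₁; proj₂)
open import Data.Sum using (_⊎_)
open import Relation.Nullary using (¬_)
open import Relation.Binary.PropositionalEquality using (_≡_)
open import Relation.Binary.Structures using (IsStrictTotalOrder)
open import Induction.WellFounded using (WellFounded)
open import Function.Bundles using (_↣_)

-- Cardinals (von Neumann): well-ordered sets (ordinals) admitting no
-- injection into a proper initial segment (initial ordinals), carrying
-- their ordinal order.

record Cardinal : Set₁ where
  field
    Carrier            : Set
    _<_                : Carrier → Carrier → Set
    isStrictTotalOrder : IsStrictTotalOrder _≡_ _<_
    wellFounded        : WellFounded _<_
    initial            : (a : Carrier) → ¬ (Carrier ↣ Σ Carrier (λ b → b < a))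

  _≤_ : Carrier → Carrier → Set
  a ≤ b = (a < b) ⊎ (a ≡ b)

open Cardinal public using (Carrier)

NonZeroCard : Cardinal → Set
NonZeroCard κ = Carrier κ

record RelSys : Set₁ where
  constructor ⟨_,_,_⟩
  field
    X : Set
    Y : Set
    R : X → Y → Set

open RelSys public

_≼T_ : RelSys → RelSys → Set
𝐑 ≼T 𝐑' = Σ (X 𝐑 → X 𝐑') λ Ψ₁ → Σ (Y 𝐑' → Y 𝐑) λ Ψ₂ →
  ∀ (x : X 𝐑) (y' : Y 𝐑') → R 𝐑' (Ψ₁ x) y' → R 𝐑 x (Ψ₂ y')

_≅T_ : RelSys → RelSys → Set
𝐑 ≅T 𝐑' = (𝐑 ≼T 𝐑') × (𝐑' ≼T 𝐑)

_⊗_ : RelSys → RelSys → RelSys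
𝐑 ⊗ 𝐑' = ⟨ X 𝐑 × X 𝐑' , Y 𝐑 × Y 𝐑' ,
           (λ xx yy → R 𝐑 (proj₁ xx) (proj₁ yy) × R 𝐑' (proj₂ xx) (proj₂ yy)) ⟩

D : (S : Set) → (S → S → Set) → (Λ : Set) → RelSys
D S _≤S_ Λ = ⟨ (Λ → S) , (Λ → S) , (λ f g → ∀ (α : Λ) → f α ≤S g α) ⟩

Dcard : Cardinal → Cardinal → RelSys
Dcard κ λ' = D (Carrier κ) (Cardinal._≤_ κ) (Carrier λ')

_≤×_ : {κ λ' : Cardinal} → Carrier κ × Carrier λ' → Carrier κ × Carrier λ' → Set
_≤×_ {κ} {λ'} p q = Cardinal._≤_ κ (proj₁ p) (proj₁ q) × Cardinal._≤_ λ' (proj₂ p) (proj₂ q)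

Dprod : Cardinal → Cardinal → RelSys
Dprod κ λ' = D (Carrier κ × Carrier λ') (_≤×_ {κ} {λ'}) (Carrier λ')

-- Dominating families: "𝔡(R) ≤ |M|" witnessed by a family indexed by M

DomFamily : RelSys → Set → Set
DomFamily 𝐑 M = Σ (M → Y 𝐑) λ d → ∀ (x : X 𝐑) → ∃ λ (m : M) → R 𝐑 x (d m)

{-# OPTIONS --safe #-}
-- Sequences into κ × λ, ordered coordinatewise, are pairs of sequences into κ
-- and into λ, so the Tukey equivalence is just (un)zipping and uses nothing
-- about the orders. The statements on dominating families follow because
-- dominating families pull back along Tukey reductions and multiply over ⊗,
-- and because 𝐑 ≼T 𝐑 ⊗ 𝐑' as soon as X 𝐑' is inhabited: this is where κ and
-- λ must be non-zero.
module Submission where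

open import Defs
open import Data.Product using (_×_; _,_; proj₁; proj₂; map; zip)
open import Data.Product.Relation.Binary.Pointwise.NonDependent using (Pointwise)
open import Function using (_∘_; const)

module _ (𝐑 𝐑' 𝐑'' : RelSys) where

  ≼T-trans : 𝐑 ≼T 𝐑' → 𝐑' ≼T 𝐑'' → 𝐑 ≼T 𝐑''
  ≼T-trans (Φ₁ , Φ₂ , Φ) (Ψ₁ , Ψ₂ , Ψ) =
    Ψ₁ ∘ Φ₁ , Φ₂ ∘ Ψ₂ , λ x y'' r → Φ x (Ψ₂ y'') (Ψ (Φ₁ x) y'' r)

module _ (𝐑 𝐑' : RelSys) where

  ≼T-⊗ˡ : X 𝐑' → 𝐑 ≼T (𝐑 ⊗ 𝐑')
  ≼T-⊗ˡ x' = (_, x') , proj₁ , λ _ _ → proj₁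

  ≼T-⊗ʳ : X 𝐑 → 𝐑' ≼T (𝐑 ⊗ 𝐑')
  ≼T-⊗ʳ x = (x ,_) , proj₂ , λ _ _ → proj₂

  DomFamily-≼T : ∀ {M} → 𝐑 ≼T 𝐑' → DomFamily 𝐑' M → DomFamily 𝐑 M
  DomFamily-≼T (Ψ₁ , Ψ₂ , Ψ) (d , dominates) =
    Ψ₂ ∘ d , λ x → let (m , r) = dominates (Ψ₁ x) in m , Ψ x (d m) r

  DomFamily-⊗ : ∀ {M N} → DomFamily 𝐑 M → DomFamily 𝐑' N → DomFamily (𝐑 ⊗ 𝐑') (M × N)
  DomFamily-⊗ (d , dominates) (d' , dominates') =
    map d d' , λ (x , x') → zip _,_ _,_ (dominates x) (dominates' x')

module _ {S T : Set} {_≤S_ : S → S → Set} {_≤T_ : T → T → Set} {Λ : Set} where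

  D-Pointwise≅T-⊗ : D (S × T) (Pointwise _≤S_ _≤T_) Λ ≅T (D S _≤S_ Λ ⊗ D T _≤T_ Λ)
  D-Pointwise≅T-⊗ =
    (unzip , zip′ , λ _ _ (r , r') α → r α , r' α) ,
    (zip′ , unzip , λ _ _ r → proj₁ ∘ r , proj₂ ∘ r)
    where
    unzip : (Λ → S × T) → (Λ → S) × (Λ → T)
    unzip f = proj₁ ∘ f , proj₂ ∘ f

    zip′ : (Λ → S) × (Λ → T) → (Λ → S × T)
    zip′ (g , h) α = g α , h α

lemma2p7 : (κ λ' : Cardinal) → NonZeroCard κ → NonZeroCard λ' →
    (Dprod κ λ' ≅T (Dcard κ λ' ⊗ Dcard λ' λ'))
    × ((M : Set) → DomFamily (Dprod κ λ') M → DomFamily (Dcard κ λ') M × DomFamily (Dcard λ' λ') M)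
    × ((M N : Set) → DomFamily (Dcard κ λ') M → DomFamily (Dcard λ' λ') N → DomFamily (Dprod κ λ') (M × N))
lemma2p7 κ λ' a b =
  Dκ×λ≅T⊗ ,
  (λ _ dom → DomFamily-≼T Dκ Dκ×λ Dκ≼TDκ×λ dom , DomFamily-≼T Dλ Dκ×λ Dλ≼TDκ×λ dom) ,
  (λ _ _ domκ domλ → DomFamily-≼T Dκ×λ (Dκ ⊗ Dλ) (proj₁ Dκ×λ≅T⊗) (DomFamily-⊗ Dκ Dλ domκ domλ))
  where
  Dκ Dλ Dκ×λ : RelSys
  Dκ = Dcard κ λ'
  Dλ = Dcard λ' λ'
  Dκ×λ = Dprod κ λ'

  Dκ×λ≅T⊗ : Dκ×λ ≅T (Dκ ⊗ Dλ)
  -- Dprod orders κ × λ by _≤×_, which unfolds to Pointwise of the two orders.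
  Dκ×λ≅T⊗ = D-Pointwise≅T-⊗ {_≤S_ = Cardinal._≤_ κ} {_≤T_ = Cardinal._≤_ λ'}

  Dκ≼TDκ×λ : Dκ ≼T Dκ×λ
  Dκ≼TDκ×λ = ≼T-trans Dκ (Dκ ⊗ Dλ) Dκ×λ (≼T-⊗ˡ Dκ Dλ (const b)) (proj₂ Dκ×λ≅T⊗)

  Dλ≼TDκ×λ : Dλ ≼T Dκ×λ
  Dλ≼TDκ×λ = ≼T-trans Dλ (Dκ ⊗ Dλ) Dκ×λ (≼T-⊗ʳ Dκ Dλ (const a)) (proj₂ Dκ×λ≅T⊗)
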